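{- Let $u,v$ be two different essential vertices of a multigraph $H$, and let $P$ be any simple path in $H$ that starts at $u$ and ends at $v$. Then every edge traversed by $P$ is essential.
   Context: Multigraphs are undirected and may have parallel edges and self-loops; self-loops and pairs of parallel edges count as cycles. An edge $e$ of $H$ is essential if it lies on a cycle of $H$, or $e$ is a bridge whose removal creates two new connected components each of which contains a cycle. An incidence is a pair $(u,e)$ with $e$ incident to $u$, where a self-loop at $u$ gives two incidences. A vertex is essential if it participates in at least three incidences with essential edges. -}

module Defs where

open import Data.Nat using (ℕ; _≥_)
open import Data.Fin using (Fin)
open import Data.Bool using (Bool; true; false)
open import Data.List using (List; []; _∷_; _++_; [_]; length)
open import Data.List.Membership.Propositional using (_∈_; _∉_)
open import Data.List.Relation.Unary.Unique.Propositional using (Unique)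
open import Data.Product using (Σ; ∃; ∃-syntax; _×_; _,_; proj₁)
open import Data.Sum using (_⊎_)
open import Relation.Nullary using (¬_)
open import Relation.Binary.PropositionalEquality using (_≡_; _≢_)

-- A finite multigraph: vertices Fin nV, edges Fin nE, each edge has two
-- endpoints (src, tgt); orientation is irrelevant (undirected).
-- Parallel edges and self-loops (src e ≡ tgt e) are allowed.
record Multigraph : Set where
  field
    nV  : ℕ
    nE  : ℕ
    src : Fin nE → Fin nV
    tgt : Fin nE → Fin nV

module _ (G : Multigraph) where
  open Multigraph G

  Vertex : Set
  Vertex = Fin nV

  Edge : Set
  Edge = Fin nE

  Joins : Edge → Vertex → Vertex → Set
  Joins e x y = (src e ≡ x × tgt e ≡ y) ⊎ (src e ≡ y × tgt e ≡ x)

  data Walk : Vertex → Vertex → Set where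
    []   : ∀ {x} → Walk x x
    step : ∀ {x y z} (e : Edge) → Joins e x y → Walk y z → Walk x z

  edges : ∀ {x y} → Walk x y → List Edge
  edges []           = []
  edges (step e _ w) = e ∷ edges w

  starts : ∀ {x y} → Walk x y → List Vertex
  starts []                 = []
  starts (step {x = x} _ _ w) = x ∷ starts w

  vertices : ∀ {x y} → Walk x y → List Vertex
  vertices {y = y} w = starts w ++ [ y ]

  IsSimplePath : ∀ {x y} → Walk x y → Set
  IsSimplePath w = Unique (vertices w)

  -- cycle: closed walk of length ≥ 1, no repeated edge, no repeated vertex
  -- (besides start = end).  Self-loops and pairs of parallel edges are cycles.
  IsCycle : ∀ {x} → Walk x x → Set
  IsCycle w = length (edges w) ≥ 1 × Unique (edges w) × Unique (starts w)

  OnCycle : Edge → Set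
  OnCycle e = Σ Vertex λ x → Σ (Walk x x) λ w → IsCycle w × e ∈ edges w

  ConnectedWithout : Edge → Vertex → Vertex → Set
  ConnectedWithout e a b = Σ (Walk a b) λ w → e ∉ edges w

  IsBridge : Edge → Set
  IsBridge e = ¬ ConnectedWithout e (src e) (tgt e)

  ComponentHasCycle : Edge → Vertex → Set
  ComponentHasCycle e a =
    Σ Vertex λ x → ConnectedWithout e a x ×
      Σ (Walk x x) λ w → IsCycle w × e ∉ edges w

  EssentialEdge : Edge → Set
  EssentialEdge e =
    OnCycle e ⊎
    (IsBridge e × ComponentHasCycle e (src e) × ComponentHasCycle e (tgt e))

  -- incidences: (e , true) is the src-end of e, (e , false) its tgt-end;
  -- a self-loop at u thus gives two incidences at u.
  Incidence : Set
  Incidence = Edge × Bool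

  incVertex : Incidence → Vertex
  incVertex (e , true)  = src e
  incVertex (e , false) = tgt e

  EssentialIncidenceAt : Vertex → Incidence → Set
  EssentialIncidenceAt u i = incVertex i ≡ u × EssentialEdge (proj₁ i)

  EssentialVertex : Vertex → Set
  EssentialVertex u =
    Σ Incidence λ i → Σ Incidence λ j → Σ Incidence λ k →
      i ≢ j × i ≢ k × j ≢ k ×
      EssentialIncidenceAt u i × EssentialIncidenceAt u j × EssentialIncidenceAt u k

-- If an edge e of P lies on no cycle, it is a bridge (connectivity in H − e is
-- decidable, so this dichotomy holds constructively).  An essential vertex a has
-- three essential incidences, at most one of them on e because bridges are not
-- loops.  Each of the other two lies on a cycle, which cannot pass through the
-- bridge e and so gives a cycle on a's side of H − e, or is a bridge f towards a
-- vertex w whose side of H − f has a cycle.  If that cycle is not reachable from a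
-- in H − e, then e lies beyond f, so w reaches src e in H − f.  This cannot happen
-- for two distinct bridges f₁, f₂ at a: the walk from w₂ to src e avoiding f₂
-- either avoids f₁ as well, joining a to w₁ in H − f₁, or passes through f₁,
-- joining w₂ to a in H − f₂.  Finally, as P is simple, its parts before and after
-- e avoid e, so both ends of e see a cycle in H − e.
module Submission where

open import Defs
open import Data.List.Membership.Propositional using (_∈_)
open import Relation.Binary.PropositionalEquality using (_≢_)

open import Data.Bool using (true; false)
open import Data.Empty using (⊥; ⊥-elim)
open import Data.Fin using (Fin)
open import Data.Fin.Properties using (_≟_; any?; injective⇒≤)
open import Data.List using (List; []; _∷_; _++_; length; lookup)
open import Data.List.Membership.Propositional using (_∉_)
open import Data.List.Membership.Propositional.Properties using (∈-++⁺ˡ; ∈-++⁺ʳ; ∈-lookup)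
open import Data.List.Relation.Binary.Subset.Propositional using (_⊆_)
open import Data.List.Relation.Unary.All as All using (All; []; _∷_)
open import Data.List.Relation.Unary.All.Properties using (¬Any⇒All¬)
open import Data.List.Relation.Unary.Any as Any using (here; there)
open import Data.List.Relation.Unary.AllPairs using ([]; _∷_)
open import Data.List.Relation.Unary.Unique.Propositional using (Unique)
open import Data.List.Relation.Unary.Unique.Propositional.Properties using (Unique[x∷xs]⇒x∉xs)
open import Data.Nat using (ℕ; zero; suc; _≤_; z≤n; s≤s)
open import Data.Nat.Properties using (≤-trans; n≤1+n)
open import Data.Product using (Σ; _×_; _,_; proj₁; proj₂)
open import Data.Sum using (_⊎_; inj₁; inj₂; [_,_])
import Data.Sum as Sum
open import Function using (Injective)
open import Relation.Nullary using (¬_; Dec; yes; no)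
open import Relation.Nullary.Decidable using (_×-dec_; _⊎-dec_; ¬?)
open import Relation.Binary.PropositionalEquality using (_≡_; refl; sym; trans; cong; subst)

module _ {A : Set} where

  ∉⇒All≢ : ∀ {x : A} {xs} → x ∉ xs → All (x ≢_) xs
  ∉⇒All≢ = ¬Any⇒All¬ _

  Unique-++-∷⁻ : ∀ (xs : List A) {y ys} → Unique (xs ++ y ∷ ys) → y ∉ xs × y ∉ ys
  Unique-++-∷⁻ []       u       = (λ ()) , Unique[x∷xs]⇒x∉xs u
  Unique-++-∷⁻ (x ∷ xs) (x∉ ∷ u) =
    (λ { (here y≡x) → All.lookup x∉ (∈-++⁺ʳ xs (here refl)) (sym y≡x)
       ; (there y∈xs) → proj₁ (Unique-++-∷⁻ xs u) y∈xs }) ,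
    proj₂ (Unique-++-∷⁻ xs u)

  Unique-++⁻ˡ : ∀ (xs : List A) {ys} → Unique (xs ++ ys) → Unique xs
  Unique-++⁻ˡ []       _        = []
  Unique-++⁻ˡ (x ∷ xs) (x∉ ∷ u) = All.tabulate (λ y∈xs → All.lookup x∉ (∈-++⁺ˡ y∈xs)) ∷ Unique-++⁻ˡ xs u

  Unique⇒lookup-injective : ∀ {xs : List A} → Unique xs → Injective _≡_ _≡_ (lookup xs)
  Unique⇒lookup-injective {x ∷ xs} _        {Fin.zero}  {Fin.zero}  _  = refl
  Unique⇒lookup-injective {x ∷ xs} (x∉ ∷ _) {Fin.zero}  {Fin.suc j} eq = ⊥-elim (All.lookup x∉ (∈-lookup j) eq)
  Unique⇒lookup-injective {x ∷ xs} (x∉ ∷ _) {Fin.suc i} {Fin.zero}  eq = ⊥-elim (All.lookup x∉ (∈-lookup i) (sym eq))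
  Unique⇒lookup-injective {x ∷ xs} (_ ∷ u)  {Fin.suc i} {Fin.suc j} eq = cong Fin.suc (Unique⇒lookup-injective u eq)

Unique⇒length≤ : ∀ {n} {xs : List (Fin n)} → Unique xs → length xs ≤ n
Unique⇒length≤ u = injective⇒≤ (Unique⇒lookup-injective u)

module _ (G : Multigraph) where
  open Multigraph G

  Joins-sym : ∀ {f x y} → Joins G f x y → Joins G f y x
  Joins-sym = Sum.swap

  Joins-src : ∀ {f x y} → Joins G f x y → src f ≡ x ⊎ src f ≡ y
  Joins-src (inj₁ (s , _)) = inj₁ s
  Joins-src (inj₂ (s , _)) = inj₂ s

  Joins-tgt : ∀ {f x y} → Joins G f x y → tgt f ≡ x ⊎ tgt f ≡ y
  Joins-tgt (inj₁ (_ , t)) = inj₂ t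
  Joins-tgt (inj₂ (_ , t)) = inj₁ t

  IsEndpoint : Edge G → Vertex G → Set
  IsEndpoint f a = src f ≡ a ⊎ tgt f ≡ a

  Joins⇒IsEndpointˡ : ∀ {f x y} → Joins G f x y → IsEndpoint f x
  Joins⇒IsEndpointˡ (inj₁ (s , _)) = inj₁ s
  Joins⇒IsEndpointˡ (inj₂ (_ , t)) = inj₂ t

  Joins-IsEndpoint : ∀ {f x y a} → Joins G f x y → IsEndpoint f a → a ≡ x ⊎ a ≡ y
  Joins-IsEndpoint j (inj₁ s) = Sum.map (trans (sym s)) (trans (sym s)) (Joins-src j)
  Joins-IsEndpoint j (inj₂ t) = Sum.map (trans (sym t)) (trans (sym t)) (Joins-tgt j)

  infixr 5 _++ʷ_

  _++ʷ_ : ∀ {x y z} → Walk G x y → Walk G y z → Walk G x z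
  []         ++ʷ q = q
  step e j p ++ʷ q = step e j (p ++ʷ q)

  ∈-edges-++ʷ⁻ : ∀ {x y z} (p : Walk G x y) {q : Walk G y z} {g} →
                 g ∈ edges G (p ++ʷ q) → g ∈ edges G p ⊎ g ∈ edges G q
  ∈-edges-++ʷ⁻ []           g∈q        = inj₂ g∈q
  ∈-edges-++ʷ⁻ (step e j p) (here g≡e) = inj₁ (here g≡e)
  ∈-edges-++ʷ⁻ (step e j p) (there g∈) = Sum.map₁ there (∈-edges-++ʷ⁻ p g∈)

  reverseʷ : ∀ {x y} → Walk G x y → Walk G y x
  reverseʷ []           = []
  reverseʷ (step e j p) = reverseʷ p ++ʷ step e (Joins-sym j) []

  edges-reverseʷ⊆ : ∀ {x y} (p : Walk G x y) → edges G (reverseʷ p) ⊆ edges G p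
  edges-reverseʷ⊆ []           ()
  edges-reverseʷ⊆ (step e j p) g∈ with ∈-edges-++ʷ⁻ (reverseʷ p) g∈
  ... | inj₁ g∈p       = there (edges-reverseʷ⊆ p g∈p)
  ... | inj₂ (here g≡e) = here g≡e

  connected-refl : ∀ {g a} → ConnectedWithout G g a a
  connected-refl = [] , λ ()

  connected-≡ : ∀ {g a b} → a ≡ b → ConnectedWithout G g a b
  connected-≡ refl = connected-refl

  connected-sym : ∀ {g a b} → ConnectedWithout G g a b → ConnectedWithout G g b a
  connected-sym (w , g∉w) = reverseʷ w , λ g∈ → g∉w (edges-reverseʷ⊆ w g∈)

  connected-trans : ∀ {g a b c} → ConnectedWithout G g a b → ConnectedWithout G g b c →
                    ConnectedWithout G g a c
  connected-trans (w , g∉w) (w′ , g∉w′) = w ++ʷ w′ , λ g∈ → [ g∉w , g∉w′ ] (∈-edges-++ʷ⁻ w g∈)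

  Joins⇒connected : ∀ {g f a b} → f ≢ g → Joins G f a b → ConnectedWithout G g a b
  Joins⇒connected f≢g j = step _ j [] , λ { (here g≡f) → f≢g (sym g≡f) ; (there ()) }

  record Occurrence {x y} (w : Walk G x y) (e : Edge G) : Set where
    field
      {p q}       : Vertex G
      before      : Walk G x p
      joins       : Joins G e p q
      after       : Walk G q y
      edges-split : edges G w ≡ edges G before ++ e ∷ edges G after

    before⊆ : edges G before ⊆ edges G w
    before⊆ g∈ = subst (_ ∈_) (sym edges-split) (∈-++⁺ˡ g∈)

    trail⇒avoids : Unique (edges G w) → e ∉ edges G before × e ∉ edges G after
    trail⇒avoids u = Unique-++-∷⁻ (edges G before) (subst Unique edges-split u)

  occurrence : ∀ {x y} (w : Walk G x y) {e} → e ∈ edges G w → Occurrence w e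
  occurrence (step f j w) (here refl) = record { before = [] ; joins = j ; after = w ; edges-split = refl }
  occurrence (step f j w) (there e∈w) =
    record { before = step f j before ; joins = joins ; after = after ; edges-split = cong (f ∷_) edges-split }
    where open Occurrence (occurrence w e∈w)

  walk-reaches-endpoint : ∀ {g e x y a} (w : Walk G x y) → g ∉ edges G w → e ∈ edges G w →
                          IsEndpoint e a → ConnectedWithout G g x a
  walk-reaches-endpoint {g} {e} {x} {a = a} w g∉w e∈w a∈e =
    [ reach x↝p , reach (connected-trans x↝p (Joins⇒connected e≢g joins)) ] (Joins-IsEndpoint joins a∈e)
    where
    open Occurrence (occurrence w e∈w)
    e≢g : e ≢ g
    e≢g = λ e≡g → g∉w (subst (_∈ edges G w) e≡g e∈w)
    x↝p : ConnectedWithout G g x p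
    x↝p = before , λ g∈ → g∉w (before⊆ g∈)
    reach : ∀ {b} → ConnectedWithout G g x b → a ≡ b → ConnectedWithout G g x a
    reach x↝b a≡b = connected-trans x↝b (connected-≡ (sym a≡b))

  IsTrail : ∀ {x y} → Walk G x y → Set
  IsTrail w = Unique (edges G w)

  head∈vertices : ∀ {x y} (w : Walk G x y) → x ∈ vertices G w
  head∈vertices []           = here refl
  head∈vertices (step _ _ _) = here refl

  IsEndpoint⇒∈vertices : ∀ {x y f a} (w : Walk G x y) → f ∈ edges G w → IsEndpoint f a → a ∈ vertices G w
  IsEndpoint⇒∈vertices (step f j w) (here refl) a∈f =
    [ (λ { refl → here refl }) , (λ { refl → there (head∈vertices w) }) ] (Joins-IsEndpoint j a∈f)
  IsEndpoint⇒∈vertices (step _ _ w) (there f∈w) a∈f = there (IsEndpoint⇒∈vertices w f∈w a∈f)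

  simplePath⇒trail : ∀ {x y} (w : Walk G x y) → IsSimplePath G w → IsTrail w
  simplePath⇒trail []           _            = []
  simplePath⇒trail (step f j w) u@(_ ∷ u′) = ∉⇒All≢ f∉w ∷ simplePath⇒trail w u′
    where
    f∉w : f ∉ edges G w
    f∉w f∈w = Unique[x∷xs]⇒x∉xs u (IsEndpoint⇒∈vertices w f∈w (Joins⇒IsEndpointˡ j))

  SimplePathWithin : ∀ {x y} → Walk G x y → Set
  SimplePathWithin {x} {y} w = Σ (Walk G x y) λ w′ → IsSimplePath G w′ × edges G w′ ⊆ edges G w

  suffix-from : ∀ {x y z} (w : Walk G y z) → IsSimplePath G w → x ∈ vertices G w →
                Σ (Walk G x z) λ w′ → IsSimplePath G w′ × edges G w′ ⊆ edges G w
  suffix-from []           u       (here refl)  = [] , u , λ ()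
  suffix-from w@(step _ _ _) u     (here refl)  = w , u , λ f∈ → f∈
  suffix-from (step _ _ w) (_ ∷ u) (there x∈w) with suffix-from w u x∈w
  ... | w′ , u′ , w′⊆w = w′ , u′ , λ f∈ → there (w′⊆w f∈)

  erase-loops : ∀ {x y} (w : Walk G x y) → SimplePathWithin w
  erase-loops []           = [] , [] ∷ [] , λ ()
  erase-loops {x} (step f j w) with erase-loops w
  ... | w′ , u , w′⊆w with Any.any? (x ≟_) (vertices G w′)
  ...   | yes x∈w′ = let w″ , u″ , w″⊆w′ = suffix-from w′ u x∈w′ in
                     w″ , u″ , λ g∈ → there (w′⊆w (w″⊆w′ g∈))
  ...   | no x∉w′  = step f j w′ , ∉⇒All≢ x∉w′ ∷ u ,
                     λ { (here g≡f) → here g≡f ; (there g∈) → there (w′⊆w g∈) }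

  length-vertices : ∀ {x y} (w : Walk G x y) → length (vertices G w) ≡ suc (length (edges G w))
  length-vertices []           = refl
  length-vertices (step _ _ w) = cong suc (length-vertices w)

  simplePath-length≤ : ∀ {x y} (w : Walk G x y) → IsSimplePath G w → length (edges G w) ≤ nV
  simplePath-length≤ w u =
    ≤-trans (n≤1+n _) (subst (_≤ nV) (length-vertices w) (Unique⇒length≤ u))

  Joins? : ∀ f x y → Dec (Joins G f x y)
  Joins? f x y = ((src f ≟ x) ×-dec (tgt f ≟ y)) ⊎-dec ((src f ≟ y) ×-dec (tgt f ≟ x))

  ShortWalkWithout : ℕ → Edge G → Vertex G → Vertex G → Set
  ShortWalkWithout n g x y = Σ (Walk G x y) λ w → g ∉ edges G w × length (edges G w) ≤ n

  shortWalkWithout? : ∀ n g x y → Dec (ShortWalkWithout n g x y)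
  shortWalkWithout? n g x y with x ≟ y
  ... | yes refl = yes ([] , (λ ()) , z≤n)
  shortWalkWithout? zero g x y | no x≢y =
    no λ { ([] , _) → x≢y refl ; (step _ _ _ , _ , ()) }
  shortWalkWithout? (suc n) g x y | no x≢y
    with any? (λ f → any? (λ z → ¬? (f ≟ g) ×-dec Joins? f x z ×-dec shortWalkWithout? n g z y))
  ... | yes (f , z , f≢g , j , w , g∉w , len≤) =
        yes (step f j w , (λ { (here g≡f) → f≢g (sym g≡f) ; (there g∈w) → g∉w g∈w }) , s≤s len≤)
  ... | no ∄first = no λ
        { ([] , _) → x≢y refl
        ; (step f j w , g∉ , s≤s len≤) →
            ∄first (f , _ , (λ f≡g → g∉ (here (sym f≡g))) , j , w , (λ g∈w → g∉ (there g∈w)) , len≤) }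

  -- Loop erasure shortens every walk to one of length ≤ nV, so a bounded search decides connectivity.
  connectedWithout? : ∀ g x y → Dec (ConnectedWithout G g x y)
  connectedWithout? g x y with shortWalkWithout? nV g x y
  ... | yes (w , g∉w , _) = yes (w , g∉w)
  ... | no ∄short = no λ (w , g∉w) →
        let w′ , u , w′⊆w = erase-loops w in
        ∄short (w′ , (λ g∈ → g∉w (w′⊆w g∈)) , simplePath-length≤ w′ u)

  connectedWithout⇒onCycle : ∀ {e} → ConnectedWithout G e (tgt e) (src e) → OnCycle G e
  connectedWithout⇒onCycle {e} (w , e∉w) with erase-loops w
  ... | w′ , u , w′⊆w =
    src e , step e (inj₁ (refl , refl)) w′ ,
    (s≤s z≤n , ∉⇒All≢ (λ e∈ → e∉w (w′⊆w e∈)) ∷ simplePath⇒trail w′ u ,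
     ∉⇒All≢ (proj₁ (Unique-++-∷⁻ (starts G w′) u)) ∷ Unique-++⁻ˡ (starts G w′) u) ,
    here refl

  onCycle⊎isBridge : ∀ e → OnCycle G e ⊎ IsBridge G e
  onCycle⊎isBridge e with connectedWithout? e (src e) (tgt e)
  ... | yes src↝tgt = inj₁ (connectedWithout⇒onCycle (connected-sym src↝tgt))
  ... | no  src↝̸tgt = inj₂ src↝̸tgt

  isBridge-Joins : ∀ {e p q} → IsBridge G e → Joins G e p q → ¬ ConnectedWithout G e p q
  isBridge-Joins br (inj₁ (refl , refl)) p↝q = br p↝q
  isBridge-Joins br (inj₂ (refl , refl)) p↝q = br (connected-sym p↝q)

  isBridge⇒src≢tgt : ∀ {e} → IsBridge G e → src e ≢ tgt e
  isBridge⇒src≢tgt br src≡tgt = br (connected-≡ src≡tgt)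

  isBridge⇒∉cycle : ∀ {e x} {C : Walk G x x} → IsBridge G e → IsCycle G C → e ∉ edges G C
  isBridge⇒∉cycle {e} {C = C} br (_ , trail , _) e∈C = isBridge-Joins br joins (connected-sym q↝p)
    where
    open Occurrence (occurrence C e∈C)
    q↝p : ConnectedWithout G e q p
    q↝p with e∉before , e∉after ← trail⇒avoids trail =
      after ++ʷ before , λ e∈ → [ e∉after , e∉before ] (∈-edges-++ʷ⁻ after e∈)

  componentHasCycle-transport : ∀ {e a b} → ConnectedWithout G e a b →
                                ComponentHasCycle G e a → ComponentHasCycle G e b
  componentHasCycle-transport a↝b (x , a↝x , cycle) = x , connected-trans (connected-sym a↝b) a↝x , cycle

  onCycle⇒componentHasCycle : ∀ {e f a} → IsBridge G e → OnCycle G f → IsEndpoint f a →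
                              ComponentHasCycle G e a
  onCycle⇒componentHasCycle {e} br (x , C , cyc , f∈C) a∈f =
    componentHasCycle-transport (walk-reaches-endpoint C e∉C f∈C a∈f) (x , connected-refl , C , cyc , e∉C)
    where
    e∉C : e ∉ edges G C
    e∉C = isBridge⇒∉cycle br cyc

  incidences-on-one-edge⇒loop : ∀ {e a} (i j : Incidence G) → i ≢ j → proj₁ i ≡ e → proj₁ j ≡ e →
                                incVertex G i ≡ a → incVertex G j ≡ a → src e ≡ tgt e
  incidences-on-one-edge⇒loop (f , true)  (_ , true)  i≢j refl refl _ _ = ⊥-elim (i≢j refl)
  incidences-on-one-edge⇒loop (f , true)  (_ , false) _   refl refl s t = trans s (sym t)
  incidences-on-one-edge⇒loop (f , false) (_ , true)  _   refl refl t s = trans s (sym t)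
  incidences-on-one-edge⇒loop (f , false) (_ , false) i≢j refl refl _ _ = ⊥-elim (i≢j refl)

  ¬incidences-on-one-bridge : ∀ {e a} → IsBridge G e → (i j : Incidence G) → i ≢ j →
                              proj₁ i ≡ e → proj₁ j ≡ e →
                              EssentialIncidenceAt G a i → EssentialIncidenceAt G a j → ⊥
  ¬incidences-on-one-bridge br i j i≢j i≡e j≡e (i∼a , _) (j∼a , _) =
    isBridge⇒src≢tgt br (incidences-on-one-edge⇒loop i j i≢j i≡e j≡e i∼a j∼a)

  BridgeTowardsCycle : Edge G → Vertex G → Set
  BridgeTowardsCycle f a = IsBridge G f × Σ (Vertex G) λ w → Joins G f a w × ComponentHasCycle G f w

  essentialIncidence-cases : ∀ {e a} → IsBridge G e → (i : Incidence G) → EssentialIncidenceAt G a i →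
                             ComponentHasCycle G e a ⊎ BridgeTowardsCycle (proj₁ i) a
  essentialIncidence-cases br (f , true)  (refl , inj₁ onCycle) =
    inj₁ (onCycle⇒componentHasCycle br onCycle (inj₁ refl))
  essentialIncidence-cases br (f , false) (refl , inj₁ onCycle) =
    inj₁ (onCycle⇒componentHasCycle br onCycle (inj₂ refl))
  essentialIncidence-cases br (f , true)  (refl , inj₂ (bridge , _ , tgt-cycle)) =
    inj₂ (bridge , tgt f , inj₁ (refl , refl) , tgt-cycle)
  essentialIncidence-cases br (f , false) (refl , inj₂ (bridge , src-cycle , _)) =
    inj₂ (bridge , src f , inj₂ (refl , refl) , src-cycle)

  componentHasCycle-across : ∀ {e f a w} → f ≢ e → Joins G f a w → ComponentHasCycle G f w →
                             ComponentHasCycle G e a ⊎ ConnectedWithout G f w (src e)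
  componentHasCycle-across {e} f≢e j (z , (W , f∉W) , C , cyc , f∉C)
    with Any.any? (e ≟_) (edges G W) | Any.any? (e ≟_) (edges G C)
  ... | yes e∈W | _       = inj₂ (walk-reaches-endpoint W f∉W e∈W (inj₁ refl))
  ... | no _    | yes e∈C = inj₂ (connected-trans (W , f∉W) (walk-reaches-endpoint C f∉C e∈C (inj₁ refl)))
  ... | no e∉W  | no e∉C  = inj₁ (z , connected-trans (Joins⇒connected f≢e j) (W , e∉W) , C , cyc , e∉C)

  ¬bridges-towards-common-vertex : ∀ {f₁ f₂ a w₁ w₂ s} → f₁ ≢ f₂ → IsBridge G f₁ → IsBridge G f₂ →
                                   Joins G f₁ a w₁ → Joins G f₂ a w₂ →
                                   ConnectedWithout G f₁ w₁ s → ConnectedWithout G f₂ w₂ s → ⊥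
  ¬bridges-towards-common-vertex {f₁} f₁≢f₂ b₁ b₂ j₁ j₂ w₁↝s (X , f₂∉X) with Any.any? (f₁ ≟_) (edges G X)
  ... | no f₁∉X = isBridge-Joins b₁ j₁
        (connected-trans (Joins⇒connected (λ f₂≡f₁ → f₁≢f₂ (sym f₂≡f₁)) j₂)
                         (connected-trans (X , f₁∉X) (connected-sym w₁↝s)))
  ... | yes f₁∈X = isBridge-Joins b₂ j₂
        (connected-sym (walk-reaches-endpoint X f₂∉X f₁∈X (Joins⇒IsEndpointˡ j₁)))

  two-essential-incidences⇒componentHasCycle :
    ∀ {e a} → IsBridge G e → (i j : Incidence G) → i ≢ j → proj₁ i ≢ e → proj₁ j ≢ e →
    EssentialIncidenceAt G a i → EssentialIncidenceAt G a j → ComponentHasCycle G e a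
  two-essential-incidences⇒componentHasCycle br i j i≢j i≢e j≢e ei ej
    with essentialIncidence-cases br i ei | essentialIncidence-cases br j ej
  ... | inj₁ cycle | _          = cycle
  ... | inj₂ _     | inj₁ cycle = cycle
  ... | inj₂ (b₁ , w₁ , j₁ , c₁) | inj₂ (b₂ , w₂ , j₂ , c₂)
    with componentHasCycle-across i≢e j₁ c₁ | componentHasCycle-across j≢e j₂ c₂
  ... | inj₁ cycle | _          = cycle
  ... | inj₂ _     | inj₁ cycle = cycle
  ... | inj₂ w₁↝s  | inj₂ w₂↝s  =
    ⊥-elim (¬bridges-towards-common-vertex f₁≢f₂ b₁ b₂ j₁ j₂ w₁↝s w₂↝s)
    where
    f₁≢f₂ : proj₁ i ≢ proj₁ j
    f₁≢f₂ f₁≡f₂ = ¬incidences-on-one-bridge b₁ i j i≢j refl (sym f₁≡f₂) ei ej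

  essentialVertex⇒componentHasCycle : ∀ {e a} → IsBridge G e → EssentialVertex G a → ComponentHasCycle G e a
  essentialVertex⇒componentHasCycle {e} br (i , j , k , i≢j , i≢k , j≢k , ei , ej , ek)
    with proj₁ i ≟ e | proj₁ j ≟ e | proj₁ k ≟ e
  ... | no i≢e  | no j≢e  | _       = two-essential-incidences⇒componentHasCycle br i j i≢j i≢e j≢e ei ej
  ... | no i≢e  | yes _   | no k≢e  = two-essential-incidences⇒componentHasCycle br i k i≢k i≢e k≢e ei ek
  ... | yes _   | no j≢e  | no k≢e  = two-essential-incidences⇒componentHasCycle br j k j≢k j≢e k≢e ej ek
  ... | yes i≡e | yes j≡e | _       = ⊥-elim (¬incidences-on-one-bridge br i j i≢j i≡e j≡e ei ej)
  ... | yes i≡e | no _    | yes k≡e = ⊥-elim (¬incidences-on-one-bridge br i k i≢k i≡e k≡e ei ek)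
  ... | no _    | yes j≡e | yes k≡e = ⊥-elim (¬incidences-on-one-bridge br j k j≢k j≡e k≡e ej ek)

  bridge-on-trail⇒essential : ∀ {e x y} (W : Walk G x y) → IsTrail W → e ∈ edges G W → IsBridge G e →
                              ComponentHasCycle G e x → ComponentHasCycle G e y → EssentialEdge G e
  bridge-on-trail⇒essential {e} {x} {y} W trail e∈W br x-cycle y-cycle =
    essential joins (componentHasCycle-transport x↝p x-cycle) (componentHasCycle-transport y↝q y-cycle)
    where
    open Occurrence (occurrence W e∈W)
    x↝p : ConnectedWithout G e x p
    x↝p = before , proj₁ (trail⇒avoids trail)
    y↝q : ConnectedWithout G e y q
    y↝q = connected-sym (after , proj₂ (trail⇒avoids trail))
    essential : ∀ {p q} → Joins G e p q → ComponentHasCycle G e p → ComponentHasCycle G e q →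
                EssentialEdge G e
    essential (inj₁ (refl , refl)) p-cycle q-cycle = inj₂ (br , p-cycle , q-cycle)
    essential (inj₂ (refl , refl)) p-cycle q-cycle = inj₂ (br , q-cycle , p-cycle)

lemma5p3 : (H : Multigraph) (u v : Vertex H) → u ≢ v →
    EssentialVertex H u → EssentialVertex H v →
    (P : Walk H u v) → IsSimplePath H P →
    ∀ e → e ∈ edges H P → EssentialEdge H e
lemma5p3 H u v _ u-essential v-essential P simple e e∈P with onCycle⊎isBridge H e
... | inj₁ onCycle = inj₁ onCycle
... | inj₂ bridge  =
  bridge-on-trail⇒essential H P (simplePath⇒trail H P simple) e∈P bridge
    (essentialVertex⇒componentHasCycle H bridge u-essential)
    (essentialVertex⇒componentHasCycle H bridge v-essential)
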